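{- Let $L=(\ell,\mathcal{B})$ be a labeled Łukasiewicz path of length $n$ with $\mathcal{B}=(\beta_1,\dots,\beta_n)$, let $\alpha$ be its corresponding parking function ($\alpha_k=m$ whenever $k\in\beta_m$), and let $\alpha_L$ be the permutation of $[n]$ (in one-line notation) obtained by listing the elements of $\beta_1$ in increasing order, then those of $\beta_2$ in increasing order, and so on through $\beta_n$. Then the descent set of $\alpha$ equals the descent set of $\alpha_L^{ -1}$, i.e. $\mathrm{Des}(\alpha)=\{i\in[n-1]:\alpha_L^{ -1}(i)>\alpha_L^{ -1}(i+1)\}$.
   Context: A Łukasiewicz path of length $n$ is a sequence $\ell=(\ell_1,\dots,\ell_n)$ of integers $\ell_i\ge-1$ with all partial sums $\sum_{i=1}^k\ell_i\ge0$ and $\sum_{i=1}^n\ell_i=0$. A labeled Łukasiewicz path is a pair $L=(\ell,\mathcal{B})$ with $\mathcal{B}=(\beta_1,\dots,\beta_n)$ an ordered sequence of pairwise disjoint (possibly empty) subsets of $[n]$ with union $[n]$ and $|\beta_i|=\ell_i+1$. For a tuple $x=(x_1,\dots,x_n)$, $\mathrm{Des}(x)=\{i\in[n-1]:x_i>x_{i+1}\}$. -}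

module Defs where

open import Data.Nat using (ℕ; zero; suc; _<_)
open import Data.Nat.Properties using (<-trans; n<1+n)
open import Data.Integer as ℤ using (ℤ; +_; -[1+_]) renaming (_≤_ to _≤ℤ_)
open import Data.Fin using (Fin; toℕ; fromℕ<) renaming (_<_ to _<ꟳ_)
open import Data.Fin.Subset using (Subset; _∈_; ∣_∣)
open import Data.Fin.Subset.Properties using (_∈?_)
open import Data.Fin.Permutation using (Permutation′; _⟨$⟩ʳ_; _⟨$⟩ˡ_)
open import Data.List using (List; []; _∷_; foldr; take; tabulate; allFin; filter; concatMap)
open import Data.Empty using (⊥)
open import Data.Product using (Σ; Σ-syntax; _×_)
open import Relation.Binary.PropositionalEquality using (_≡_; _≢_)

sumℤ : List ℤ → ℤ
sumℤ = foldr ℤ._+_ (+ 0)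

-- The list (ℓ₁, …, ℓₙ) of a step sequence indexed by Fin n (index 0 = ℓ₁).
steps : ∀ {n} → (Fin n → ℤ) → List ℤ
steps ℓ = tabulate ℓ

partialSum : ∀ {n} → (Fin n → ℤ) → ℕ → ℤ
partialSum ℓ k = sumℤ (take k (steps ℓ))

record IsŁukasiewicz (n : ℕ) (ℓ : Fin n → ℤ) : Set where
  field
    steps≥-1    : ∀ i → -[1+ 0 ] ≤ℤ ℓ i
    partial≥0   : ∀ k → k Data.Nat.≤ n → + 0 ≤ℤ partialSum ℓ k
    total≡0     : partialSum ℓ n ≡ + 0

-- Labeled Łukasiewicz path L = (ℓ, B), B = (β₁, …, βₙ) (index 0 = β₁).
record LabeledŁukasiewicz (n : ℕ) : Set where
  field
    ℓ       : Fin n → ℤ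
    β       : Fin n → Subset n
    isŁuk   : IsŁukasiewicz n ℓ
    disjoint : ∀ i j → i ≢ j → ∀ k → k ∈ β i → k ∈ β j → ⊥
    covers  : ∀ k → Σ[ m ∈ Fin n ] k ∈ β m
    sizes   : ∀ i → + ∣ β i ∣ ≡ ℓ i ℤ.+ + 1

open LabeledŁukasiewicz public

IsParkingFunctionOf : ∀ {n} → LabeledŁukasiewicz n → (Fin n → Fin n) → Set
IsParkingFunctionOf L α = ∀ k m → k ∈ β L m → α k ≡ m

elems : ∀ {n} → Subset n → List (Fin n)
elems {n} p = filter (_∈? p) (allFin n)

oneLineαL : ∀ {n} → LabeledŁukasiewicz n → List (Fin n)
oneLineαL {n} L = concatMap (λ m → elems (β L m)) (allFin n)

oneLine : ∀ {n} → Permutation′ n → List (Fin n)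
oneLine σ = tabulate (σ ⟨$⟩ʳ_)

-- Descent set of a tuple x (0-based positions): i ∈ Des x iff i+1 < n and x_i > x_{i+1}.
-- (Position i here corresponds to i+1 ∈ [n-1] in the paper's 1-based indexing.)
Des : ∀ {n} → (Fin n → Fin n) → ℕ → Set
Des {n} x i = Σ[ p ∈ suc i < n ] (x (fromℕ< p) <ꟳ x (fromℕ< (<-trans (n<1+n i) p)))

inv : ∀ {n} → Permutation′ n → Fin n → Fin n
inv σ = σ ⟨$⟩ˡ_

{-# OPTIONS --safe #-}
module Submission where

-- Order the positions lexicographically by (α k, k). Listing β₁, …, βₙ, each in
-- increasing order, lists [n] in exactly this order, so αL⁻¹ k is the rank of k:
-- αL⁻¹ is the standardization of α. For positions a < b a tie α a = α b is broken
-- in favour of a, so α b < α a iff αL⁻¹ b < αL⁻¹ a. Hence α and αL⁻¹ have the same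
-- inversions, in particular the same descents.

open import Defs
open import Data.Nat using (ℕ; suc; s<s) renaming (_<_ to _<ℕ_)
import Data.Nat.Properties as ℕ
open import Data.Fin using (Fin; fromℕ<; _<_)
import Data.Fin as Fin
open import Data.Fin.Properties using (toℕ-fromℕ<; <-cmp; <-asym)
open import Data.Fin.Permutation using (Permutation′; inverseʳ)
open import Data.List using (List; tabulate; allFin)
open import Data.List.Relation.Unary.All as All using (All; []; _∷_)
import Data.List.Relation.Unary.All.Properties as All
open import Data.List.Relation.Unary.AllPairs as AllPairs using (AllPairs; []; _∷_)
import Data.List.Relation.Unary.AllPairs.Properties as AllPairs
open import Data.Product using (_×_; _,_)
open import Data.Product.Relation.Binary.Lex.Strict using (×-Lex; ×-asymmetric)
open import Data.Sum using (inj₁; inj₂)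
open import Data.Empty using (⊥-elim)
open import Function using (id; _on_)
open import Function.Bundles using (_⇔_; mk⇔; Equivalence)
open import Level using (Level; 0ℓ)
open import Relation.Binary.Core using (Rel)
open import Relation.Binary.Definitions using (Asymmetric; tri<; tri≈; tri>)
open import Relation.Binary.PropositionalEquality
  using (_≡_; refl; sym; trans; subst; subst₂; resp₂)

private
  variable
    a p r : Level
    A : Set a
    n : ℕ

AllPairs-mapWithAll : {P : A → Set p} {R S : Rel A r} {xs : List A} →
                      (∀ {x y} → P x → P y → R x y → S x y) →
                      All P xs → AllPairs R xs → AllPairs S xs
AllPairs-mapWithAll f [] [] = []
AllPairs-mapWithAll f (px ∷ pxs) (rxs ∷ rxss) =
  All.zipWith (λ (py , r) → f px py r) (pxs , rxs) ∷ AllPairs-mapWithAll f pxs rxss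

AllPairs-tabulate⁻ : {R : Rel A r} {f : Fin n → A} →
                     AllPairs R (tabulate f) → ∀ {i j} → i < j → R (f i) (f j)
AllPairs-tabulate⁻ (r ∷ _) {Fin.zero} {Fin.suc j} _ = All.tabulate⁻ r j
AllPairs-tabulate⁻ (_ ∷ rs) {Fin.suc i} {Fin.suc j} (s<s i<j) =
  AllPairs-tabulate⁻ rs i<j

AllPairs-tabulate⇒reflects : {R : Rel A r} → Asymmetric R → {f : Fin n → A} →
                             AllPairs R (tabulate f) → ∀ {i j} → R (f i) (f j) → i < j
AllPairs-tabulate⇒reflects asym sorted {i} {j} r with <-cmp i j
... | tri< i<j _ _ = i<j
... | tri≈ _ refl _ = ⊥-elim (asym r r)
... | tri> _ _ j<i = ⊥-elim (asym r (AllPairs-tabulate⁻ sorted j<i))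

oneLine-sorted⇒inverse-strictMono : {R : Rel (Fin n) r} → Asymmetric R →
                                    (σ : Permutation′ n) → AllPairs R (oneLine σ) →
                                    ∀ {a b} → R a b → inv σ a < inv σ b
oneLine-sorted⇒inverse-strictMono {R = R} asym σ sorted r =
  AllPairs-tabulate⇒reflects asym sorted
    (subst₂ R (sym (inverseʳ σ)) (sym (inverseʳ σ)) r)

SameInversions : (x y : Fin n → Fin n) → Set
SameInversions x y = ∀ {a b} → a < b → (x b < x a ⇔ y b < y a)

sameInversions⇒sameDes : {x y : Fin n → Fin n} → SameInversions x y →
                         ∀ i → Des x i ⇔ Des y i
sameInversions⇒sameDes same i =
  mk⇔ (λ (p , d) → p , Equivalence.to (same (i<1+i p)) d)
      (λ (p , d) → p , Equivalence.from (same (i<1+i p)) d)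
  where
  i<1+i : ∀ {n} (p : suc i <ℕ n) → fromℕ< (ℕ.<-trans (ℕ.n<1+n i) p) < fromℕ< p
  i<1+i p = subst₂ _<ℕ_ (sym (toℕ-fromℕ< _)) (sym (toℕ-fromℕ< p)) (ℕ.n<1+n i)

module Standardization (α : Fin n → Fin n) where

  key : Fin n → Fin n × Fin n
  key k = α k , k

  _≺_ : Rel (Fin n) 0ℓ
  _≺_ = ×-Lex _≡_ _<_ _<_ on key

  ≺-asym : Asymmetric _≺_
  ≺-asym {a} {b} = ×-asymmetric sym (resp₂ _<_) <-asym <-asym {key a} {key b}

  sorted⇒sameInversions : (σ : Permutation′ n) → AllPairs _≺_ (oneLine σ) →
                          SameInversions α (inv σ)
  sorted⇒sameInversions σ sorted {a} {b} a<b = mk⇔ to from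
    where
    mono : ∀ {x y} → x ≺ y → inv σ x < inv σ y
    mono = oneLine-sorted⇒inverse-strictMono ≺-asym σ sorted

    to : α b < α a → inv σ b < inv σ a
    to αb<αa = mono (inj₁ αb<αa)

    from : inv σ b < inv σ a → α b < α a
    from σ⁻¹b<σ⁻¹a with <-cmp (α a) (α b)
    ... | tri< αa<αb _ _ = ⊥-elim (<-asym σ⁻¹b<σ⁻¹a (mono (inj₁ αa<αb)))
    ... | tri≈ _ αa≡αb _ = ⊥-elim (<-asym σ⁻¹b<σ⁻¹a (mono (inj₂ (αa≡αb , a<b))))
    ... | tri> _ _ αb<αa = αb<αa

  module _ (L : LabeledŁukasiewicz n) (isPF : IsParkingFunctionOf L α) where

    block-value : ∀ m → All (λ k → α k ≡ m) (elems (β L m))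
    block-value m = All.map (isPF _ m) (All.all-filter _ (allFin n))

    block-sorted : ∀ m → AllPairs _≺_ (elems (β L m))
    block-sorted m =
      AllPairs-mapWithAll (λ αx≡m αy≡m x<y → inj₂ (trans αx≡m (sym αy≡m) , x<y))
        (block-value m) (AllPairs.filter⁺ _ (AllPairs.tabulate⁺-< id))

    blocks-ordered : ∀ {m m′} → m < m′ →
                     All (λ x → All (x ≺_) (elems (β L m′))) (elems (β L m))
    blocks-ordered {m} {m′} m<m′ =
      All.map (λ αx≡m → All.map (λ αy≡m′ → inj₁ (subst₂ _<_ (sym αx≡m) (sym αy≡m′) m<m′))
                                (block-value m′))
              (block-value m)

    oneLineαL-sorted : AllPairs _≺_ (oneLineαL L)
    oneLineαL-sorted = AllPairs.concat⁺
      (All.map⁺ (All.tabulate⁺ block-sorted))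
      (AllPairs.map⁺ (AllPairs.tabulate⁺-< blocks-ordered))

proposition4p10 : (n : ℕ) (L : LabeledŁukasiewicz n) (α : Fin n → Fin n)
                  → IsParkingFunctionOf L α
                  → (αL : Permutation′ n) → oneLine αL ≡ oneLineαL L
                  → ∀ (i : ℕ) → Des α i ⇔ Des (inv αL) i
proposition4p10 n L α isPF αL αL≡ =
  sameInversions⇒sameDes
    (sorted⇒sameInversions αL (subst (AllPairs _≺_) (sym αL≡) (oneLineαL-sorted L isPF)))
  where open Standardization α
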